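{- Let $n\ge 1$. The bijection $\Psi:\mathcal{NC}_n\to\mathcal{C}_n$ restricts to a bijection from the set $\mathcal{SNC}_n$ of symmetric non-crossing partitions (with $\epsilon=0$) onto the set $\mathcal{SC}_n$ of symmetric chord diagrams.
   Context: $\mathcal{NC}_n$ is the set of non-crossing partitions of $[n]$ (no $i<j<k<l$ with $i,k$ in one block and $j,l$ in another block). With $\epsilon=0$, a partition $\pi\in\mathcal{NC}_n$ is symmetric if, for the involution $i\mapsto n+2-i$ of $[n]$ (taken modulo $n$ with values in $[n]$, so that $1\mapsto 1$), the image of every block of $\pi$ is again a block of $\pi$. $\mathcal{SNC}_n$ is the set of such partitions. $\mathcal{C}_n$ is the set of non-crossing perfect matchings of $2n$ points at positions $1,\dots,2n$ on a line, labelled $1,1',2,2',\dots,n,n'$ (label $k$ at position $2k-1$, label $k'$ at position $2k$). $\mathcal{SC}_n\subseteq\mathcal{C}_n$ consists of those matchings invariant under the reflection $p\mapsto 2n+1-p$ of positions, i.e. symmetric about the vertical line through the middle. $\Psi(\pi)$: for each block $\{b_1<\dots<b_p\}$ of $\pi$, take the pairs $(b_k,b_{k+1})$ for $k<p$ and $(b_p,b_1)$ (the pair $(b_1,b_1)$ if $p=1$); for each pair $(i,j)$, draw an arch joining point $i$ to point $(j-1)'$, where $0'=n'$. -}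

module Defs where

open import Data.Nat using (ℕ; zero; suc; _+_; _*_; _∸_; _≤_; _<_)
open import Data.Fin using (Fin; toℕ; opposite)
open import Data.Bool using (Bool; true; false)
open import Data.Product using (Σ; ∃; ∃-syntax; _×_; _,_)
open import Data.Sum using (_⊎_)
open import Data.Empty using (⊥)
open import Relation.Nullary using (¬_)
open import Relation.Binary.PropositionalEquality using (_≡_; _≢_)

-- Conventions: the ground set [n] = {1,…,n} is represented by Fin n,
-- element i : Fin n standing for label toℕ i + 1.
-- A partition of [n] is given by its (decidable) "same block" relation.

BlockRel : ℕ → Set
BlockRel n = Fin n → Fin n → Bool

IsPartition : ∀ {n} → BlockRel n → Set
IsPartition {n} R =
  (∀ (i : Fin n) → R i i ≡ true) ×
  (∀ (i j : Fin n) → R i j ≡ true → R j i ≡ true) ×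
  (∀ (i j k : Fin n) → R i j ≡ true → R j k ≡ true → R i k ≡ true)

NonCrossingP : ∀ {n} → BlockRel n → Set
NonCrossingP {n} R = ∀ (i j k l : Fin n) →
  toℕ i < toℕ j → toℕ j < toℕ k → toℕ k < toℕ l →
  ¬ (R i k ≡ true × R j l ≡ true × R i j ≡ false)

IsNC : ∀ {n} → BlockRel n → Set
IsNC R = IsPartition R × NonCrossingP R

-- the involution i ↦ n+2-i (mod n, values in [n]) on 0-indexed labels:
-- 0 ↦ 0 and k ↦ n - k for 1 ≤ k ≤ n-1
σℕ : ℕ → ℕ → ℕ
σℕ n zero = zero
σℕ n (suc k) = n ∸ suc k

ImageOfBlock : ∀ {n} → BlockRel n → Fin n → Fin n → Set
ImageOfBlock {n} R i x = ∃[ j ] (R i j ≡ true × toℕ x ≡ σℕ n (toℕ j))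

IsSymmetricP : ∀ {n} → BlockRel n → Set
IsSymmetricP {n} R = ∀ (i : Fin n) → ∃[ k ] (∀ (x : Fin n) →
  (ImageOfBlock R i x → R k x ≡ true) × (R k x ≡ true → ImageOfBlock R i x))

IsSNC : ∀ {n} → BlockRel n → Set
IsSNC R = IsNC R × IsSymmetricP R

_≐P_ : ∀ {n} → BlockRel n → BlockRel n → Set
_≐P_ {n} R R' = ∀ (i j : Fin n) → R i j ≡ R' i j

-- Position p : Fin (2 * n) stands for paper
-- position toℕ p + 1; label k (1-indexed) sits at 0-indexed position 2(k-1),
-- label k' at 0-indexed position 2(k-1)+1. A diagram is its arch relation.
ArchRel : ℕ → Set₁
ArchRel n = Fin (2 * n) → Fin (2 * n) → Set

IsPerfectMatching : ∀ n → ArchRel n → Set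
IsPerfectMatching n M =
  (∀ p q → M p q → M q p) ×
  (∀ p q → M p q → p ≢ q) ×
  (∀ p → ∃[ q ] (M p q × (∀ q' → M p q' → q' ≡ q)))

NonCrossingM : ∀ n → ArchRel n → Set
NonCrossingM n M = ∀ (a b c d : Fin (2 * n)) →
  toℕ a < toℕ b → toℕ b < toℕ c → toℕ c < toℕ d → ¬ (M a c × M b d)

IsC : ∀ n → ArchRel n → Set
IsC n M = IsPerfectMatching n M × NonCrossingM n M

-- invariance under the reflection p ↦ 2n+1-p (opposite on Fin (2n))
IsSymmetricM : ∀ n → ArchRel n → Set
IsSymmetricM n M = ∀ (p q : Fin (2 * n)) →
  (M p q → M (opposite {2 * n} p) (opposite {2 * n} q)) ×
  (M (opposite {2 * n} p) (opposite {2 * n} q) → M p q)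

IsSC : ∀ n → ArchRel n → Set
IsSC n M = IsC n M × IsSymmetricM n M

EqM : ∀ n → ArchRel n → ArchRel n → Set
EqM n M M' = ∀ (p q : Fin (2 * n)) → (M p q → M' p q) × (M' p q → M p q)

-- The pairs of Ψ for a block b_1<…<b_p: (b_k, b_{k+1}) and (b_p, b_1).
CycPair : ∀ {n} → BlockRel n → Fin n → Fin n → Set
CycPair {n} R i j =
  (toℕ i < toℕ j × R i j ≡ true ×
     (∀ (k : Fin n) → toℕ i < toℕ k → toℕ k < toℕ j → R i k ≡ false))
  ⊎ (R i j ≡ true ×
     (∀ (k : Fin n) → R i k ≡ true → toℕ j ≤ toℕ k) ×
     (∀ (k : Fin n) → R i k ≡ true → toℕ k ≤ toℕ i))

-- 0-indexed label of (j-1)' given 0-indexed label of j, with 0' = n'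
prevℕ : ℕ → ℕ → ℕ
prevℕ n zero = n ∸ 1
prevℕ n (suc k) = k

-- the arch from point i to point (j-1)' for a pair (i,j)
PsiArch : ∀ {n} → BlockRel n → Fin (2 * n) → Fin (2 * n) → Set
PsiArch {n} R p q = ∃[ i ] ∃[ j ] (CycPair R i j ×
  toℕ p ≡ 2 * toℕ i × toℕ q ≡ 2 * prevℕ n (toℕ j) + 1)

Ψ : ∀ n → BlockRel n → ArchRel n
Ψ n R p q = PsiArch {n} R p q ⊎ PsiArch {n} R q p

-- Ψ turns each pair (i, j), j the cyclic successor of i in its block, into the arch from the point i to
-- the point (j−1)′. So j is the cyclic successor of i iff j lies in the block of i and no element of that
-- block labels a point on the arc running from i rightwards, cyclically, to (j−1)′. This description makes
-- Ψ R non-crossing: two arches of one block would put a block point on such an arc, and crossing arches of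
-- two blocks have interleaved labels. It is also invariant under reflecting the line, which acts on labels
-- by i ↦ n+2−i, so R is symmetric iff Ψ R is. A partition is determined by its cyclic successors, whence
-- injectivity. Conversely, a non-crossing matching M gives the partition in which i and j are together iff
-- the positions from the point i up to the point j form a union of arches. The inside of an arch is such
-- a union, hence of even length, so every arch joins a point k to a point l′; the arc description then
-- identifies Ψ of that partition with M.

module Submission where

open import Defs
open import Data.Bool using (Bool; true; false; not; _∧_; _xor_)
open import Data.Bool.Properties using (¬-not; not-¬; xor-comm; xor-assoc; xor-same) renaming (_≟_ to _≟ᵇ_)
open import Data.Empty using (⊥; ⊥-elim)
open import Data.Fin using (Fin; zero; suc; toℕ; fromℕ<; opposite)
open import Data.Fin.Properties using (toℕ-injective; toℕ<n; toℕ-fromℕ<; opposite-prop; opposite-involutive; all?)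
open import Data.Nat
  using (ℕ; zero; suc; _+_; _*_; _∸_; _≤_; _<_; _≟_; _≤?_; _<?_; z≤n; s≤s; z<s; s≤s⁻¹; parity; ⌈_/2⌉)
open import Data.Nat.DivMod using (_mod_; _%_; m≤n⇒m%n≡m; n%n≡0)
open import Data.Nat.Properties
open import Data.Parity.Base using (0ℙ; 1ℙ; _⁻¹)
import Data.Parity.Base as ℙ
open import Data.Parity.Properties using (⁻¹-involutive; suc-homo-⁻¹; +-homo-+; *-homo-*)
open import Data.Product using (∃; ∃-syntax; _×_; _,_; proj₁; proj₂)
open import Data.Sum using (_⊎_; inj₁; inj₂)
open import Function using (_∘_)
open import Level using (0ℓ)
open import Relation.Binary.Definitions using (tri<; tri≈; tri>)
open import Relation.Binary.PropositionalEquality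
  using (_≡_; _≢_; ≢-sym; refl; sym; trans; cong; cong₂; subst; subst₂; module ≡-Reasoning)
open import Relation.Nullary using (¬_; Dec; yes; no)
open import Relation.Nullary.Decidable using (_×-dec_; does; dec-true; dec-false; map′)
open import Relation.Unary using (Pred; Decidable)

open ≡-Reasoning

≡true⇔⇒≡ : ∀ {a b : Bool} → (a ≡ true → b ≡ true) → (b ≡ true → a ≡ true) → a ≡ b
≡true⇔⇒≡ {false} {false} _ _ = refl
≡true⇔⇒≡ {false} {true}  _ g = g refl
≡true⇔⇒≡ {true}  {false} f _ = sym (f refl)
≡true⇔⇒≡ {true}  {true}  _ _ = refl

dec-true⁻¹ : ∀ {A : Set} (a? : Dec A) → does a? ≡ true → A
dec-true⁻¹ (yes a) _ = a

least? : ∀ {k} {P : Pred (Fin k) 0ℓ} → Decidable P →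
  (∃ λ x → P x × (∀ y → P y → toℕ x ≤ toℕ y)) ⊎ (∀ y → ¬ P y)
least? {zero} P? = inj₂ λ ()
least? {suc k} P? with P? zero
... | yes p0 = inj₁ (zero , p0 , λ _ _ → z≤n)
... | no ¬p0 with least? (P? ∘ suc)
...   | inj₁ (x , px , min) = inj₁ (suc x , px , λ { zero p0 → ⊥-elim (¬p0 p0) ; (suc y) py → s≤s (min y py) })
...   | inj₂ none = inj₂ λ { zero → ¬p0 ; (suc y) → none y }

greatest? : ∀ {k} {P : Pred (Fin k) 0ℓ} → Decidable P →
  (∃ λ x → P x × (∀ y → P y → toℕ y ≤ toℕ x)) ⊎ (∀ y → ¬ P y)
greatest? {zero} P? = inj₂ λ ()
greatest? {suc k} P? with greatest? (P? ∘ suc)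
... | inj₁ (x , px , max) = inj₁ (suc x , px , λ { zero _ → z≤n ; (suc y) py → s≤s (max y py) })
... | inj₂ none with P? zero
...   | yes p0 = inj₁ (zero , p0 , λ { zero _ → z≤n ; (suc y) py → ⊥-elim (none y py) })
...   | no ¬p0 = inj₂ λ { zero → ¬p0 ; (suc y) → none y }

module _ {n} {R : BlockRel n} where

  CycPair⇒R : ∀ {i j} → CycPair R i j → R i j ≡ true
  CycPair⇒R (inj₁ (_ , Rij , _)) = Rij
  CycPair⇒R (inj₂ (Rij , _ , _)) = Rij

  CycPair-functional : ∀ {i j j′} → CycPair R i j → CycPair R i j′ → j ≡ j′
  CycPair-functional {j = j} {j′} (inj₁ (i<j , Rij , gap)) (inj₁ (i<j′ , Rij′ , gap′))
    with <-cmp (toℕ j) (toℕ j′)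
  ... | tri< j<j′ _ _ = ⊥-elim (not-¬ Rij (gap′ j i<j j<j′))
  ... | tri≈ _ j≡j′ _ = toℕ-injective j≡j′
  ... | tri> _ _ j′<j = ⊥-elim (not-¬ Rij′ (gap j′ i<j′ j′<j))
  CycPair-functional (inj₁ (i<j , Rij , _)) (inj₂ (_ , _ , max)) = ⊥-elim (<⇒≱ i<j (max _ Rij))
  CycPair-functional (inj₂ (_ , _ , max)) (inj₁ (i<j′ , Rij′ , _)) = ⊥-elim (<⇒≱ i<j′ (max _ Rij′))
  CycPair-functional (inj₂ (Rij , min , _)) (inj₂ (Rij′ , min′ , _)) =
    toℕ-injective (≤-antisym (min _ Rij′) (min′ _ Rij))

module Blocks {n} {R : BlockRel n} (isP : IsPartition R) where

  R-refl : ∀ i → R i i ≡ true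
  R-refl = proj₁ isP

  R-sym : ∀ {i j} → R i j ≡ true → R j i ≡ true
  R-sym = proj₁ (proj₂ isP) _ _

  R-trans : ∀ {i j k} → R i j ≡ true → R j k ≡ true → R i k ≡ true
  R-trans = proj₂ (proj₂ isP) _ _ _

  R? : ∀ i j → Dec (R i j ≡ true)
  R? i j = R i j ≟ᵇ true

  CycPair-injective : ∀ {i i′ j} → CycPair R i j → CycPair R i′ j → i ≡ i′
  CycPair-injective {i} {i′} (inj₁ (i<j , Rij , gap)) (inj₁ (i′<j , Ri′j , gap′))
    with <-cmp (toℕ i) (toℕ i′)
  ... | tri< i<i′ _ _ = ⊥-elim (not-¬ (R-trans Rij (R-sym Ri′j)) (gap i′ i<i′ i′<j))
  ... | tri≈ _ i≡i′ _ = toℕ-injective i≡i′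
  ... | tri> _ _ i′<i = ⊥-elim (not-¬ (R-trans Ri′j (R-sym Rij)) (gap′ i i′<i i<j))
  CycPair-injective (inj₁ (i<j , Rij , _)) (inj₂ (Ri′j , min′ , _)) =
    ⊥-elim (<⇒≱ i<j (min′ _ (R-trans Ri′j (R-sym Rij))))
  CycPair-injective (inj₂ (Rij , min , _)) (inj₁ (i′<j , Ri′j , _)) =
    ⊥-elim (<⇒≱ i′<j (min _ (R-trans Rij (R-sym Ri′j))))
  CycPair-injective (inj₂ (Rij , _ , max)) (inj₂ (Ri′j , _ , max′)) =
    toℕ-injective (≤-antisym (max′ _ (R-trans Ri′j (R-sym Rij))) (max _ (R-trans Rij (R-sym Ri′j))))

  cycSucc : ∀ i → ∃ (CycPair R i)
  cycSucc i with least? (λ k → R? i k ×-dec (toℕ i <? toℕ k))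
  ... | inj₁ (j , (Rij , i<j) , min) =
    j , inj₁ (i<j , Rij , λ k i<k k<j → ¬-not λ Rik → <⇒≱ k<j (min k (Rik , i<k)))
  ... | inj₂ none with least? (R? i)
  ...   | inj₁ (j , Rij , min) = j , inj₂ (Rij , min , λ k Rik → ≮⇒≥ λ i<k → none k (Rik , i<k))
  ...   | inj₂ empty = ⊥-elim (empty i (R-refl i))

  cycPred : ∀ j → ∃ λ i → CycPair R i j
  cycPred j with greatest? (λ k → R? j k ×-dec (toℕ k <? toℕ j))
  ... | inj₁ (i , (Rji , i<j) , max) =
    i , inj₁ (i<j , R-sym Rji , λ k i<k k<j → ¬-not λ Rik → <⇒≱ i<k (max k (R-trans Rji Rik , k<j)))
  ... | inj₂ none with greatest? (R? j)
  ...   | inj₁ (i , Rji , max) = i , inj₂ (R-sym Rji ,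
          (λ k Rik → ≮⇒≥ λ k<j → none k (R-trans Rji Rik , k<j)) ,
          (λ k Rik → max k (R-trans Rji Rik)))
  ...   | inj₂ empty = ⊥-elim (empty j (R-refl j))

  next-in-block : ∀ {i j} → R i j ≡ true → toℕ i < toℕ j →
    ∃ λ k → CycPair R i k × toℕ i < toℕ k × toℕ k ≤ toℕ j
  next-in-block {i} {j} Rij i<j with cycSucc i
  ... | k , c@(inj₁ (i<k , _ , gap)) = k , c , i<k , ≮⇒≥ λ j<k → not-¬ Rij (gap j i<j j<k)
  ... | _ , inj₂ (_ , _ , max) = ⊥-elim (<⇒≱ i<j (max j Rij))

module _ {n} {R R′ : BlockRel n} (isP : IsPartition R) (isP′ : IsPartition R′)
         (⊆ : ∀ {i j} → CycPair R i j → CycPair R′ i j) where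
  open Blocks isP
  open Blocks isP′ using () renaming (R-refl to R′-refl; R-sym to R′-sym; R-trans to R′-trans)

  private
    upward : ∀ d i j → toℕ j ≤ d + toℕ i → toℕ i < toℕ j → R i j ≡ true → R′ i j ≡ true
    upward zero i j j≤i i<j _ = ⊥-elim (<⇒≱ i<j j≤i)
    upward (suc d) i j j≤d+i i<j Rij with next-in-block Rij i<j
    ... | k , c , i<k , k≤j with toℕ k ≟ toℕ j
    ...   | yes k≡j = subst (λ x → R′ i x ≡ true) (toℕ-injective k≡j) (CycPair⇒R {R = R′} (⊆ c))
    ...   | no k≢j = R′-trans (CycPair⇒R {R = R′} (⊆ c))
            (upward d k j (≤-trans j≤d+i (≤-trans (≤-reflexive (sym (+-suc d (toℕ i)))) (+-monoʳ-≤ d i<k)))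
                    (≤∧≢⇒< k≤j k≢j) (R-trans (R-sym (CycPair⇒R {R = R} c)) Rij))

  CycPair-⊆⇒⊆ : ∀ i j → R i j ≡ true → R′ i j ≡ true
  CycPair-⊆⇒⊆ i j Rij with <-cmp (toℕ i) (toℕ j)
  ... | tri< i<j _ _ = upward (toℕ j) i j (m≤m+n (toℕ j) (toℕ i)) i<j Rij
  ... | tri≈ _ i≡j _ = subst (λ x → R′ i x ≡ true) (toℕ-injective i≡j) (R′-refl i)
  ... | tri> _ _ j<i = R′-sym (upward (toℕ i) j i (m≤m+n (toℕ i) (toℕ j)) j<i (R-sym Rij))

CycPair⇔⇒≐P : ∀ {n} {R R′ : BlockRel n} → IsPartition R → IsPartition R′ →
  (∀ {i j} → CycPair R i j → CycPair R′ i j) → (∀ {i j} → CycPair R′ i j → CycPair R i j) → R ≐P R′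
CycPair⇔⇒≐P isP isP′ ⊆ ⊇ i j =
  ≡true⇔⇒≡ (CycPair-⊆⇒⊆ isP isP′ ⊆ i j) (CycPair-⊆⇒⊆ isP′ isP ⊇ i j)

even-or-odd : ∀ k → (∃ λ h → k ≡ 2 * h) ⊎ (∃ λ h → k ≡ 2 * h + 1)
even-or-odd zero = inj₁ (0 , refl)
even-or-odd (suc k) with even-or-odd k
... | inj₁ (h , refl) = inj₂ (h , +-comm 1 (2 * h))
... | inj₂ (h , refl) = inj₁ (suc h , trans (cong suc (+-comm (2 * h) 1)) (sym (*-suc 2 h)))

parity-even : ∀ h → parity (2 * h) ≡ 0ℙ
parity-even h = *-homo-* 2 h

parity-odd : ∀ h → parity (2 * h + 1) ≡ 1ℙ
parity-odd h = trans (+-homo-+ (2 * h) 1) (cong (ℙ._+ 1ℙ) (parity-even h))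

⌈2h/2⌉≡h : ∀ h → ⌈ 2 * h /2⌉ ≡ h
⌈2h/2⌉≡h zero = refl
⌈2h/2⌉≡h (suc h) = trans (cong ⌈_/2⌉ (*-suc 2 h)) (cong suc (⌈2h/2⌉≡h h))

⌈2h+1/2⌉≡1+h : ∀ h → ⌈ 2 * h + 1 /2⌉ ≡ suc h
⌈2h+1/2⌉≡1+h zero = refl
⌈2h+1/2⌉≡1+h (suc h) = trans (cong (λ x → ⌈ x + 1 /2⌉) (*-suc 2 h)) (cong suc (⌈2h+1/2⌉≡1+h h))

2a<y⇒a<⌈y/2⌉ : ∀ {a y} → 2 * a < y → a < ⌈ y /2⌉
2a<y⇒a<⌈y/2⌉ {a} {y} 2a<y =
  subst (_≤ ⌈ y /2⌉) (⌈2h+1/2⌉≡1+h a) (⌈n/2⌉-mono (subst (_≤ y) (+-comm 1 (2 * a)) 2a<y))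

y≤2b⇒⌈y/2⌉≤b : ∀ {b y} → y ≤ 2 * b → ⌈ y /2⌉ ≤ b
y≤2b⇒⌈y/2⌉≤b {b} {y} y≤2b = subst (⌈ y /2⌉ ≤_) (⌈2h/2⌉≡h b) (⌈n/2⌉-mono y≤2b)

a≤b⇒2a<2b+1 : ∀ {a b} → a ≤ b → 2 * a < 2 * b + 1
a≤b⇒2a<2b+1 {a} {b} a≤b = subst (2 * a <_) (+-comm 1 (2 * b)) (s≤s (*-monoʳ-≤ 2 a≤b))

b<a⇒2b+1<2a : ∀ {a b} → b < a → 2 * b + 1 < 2 * a
b<a⇒2b+1<2a {a} {b} b<a = subst (_≤ 2 * a) (trans (*-suc 2 b) (cong suc (+-comm 1 (2 * b)))) (*-monoʳ-≤ 2 b<a)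

2b+1<2a⇒b<a : ∀ {a b} → 2 * b + 1 < 2 * a → b < a
2b+1<2a⇒b<a h = ≰⇒> λ a≤b → <-asym h (a≤b⇒2a<2b+1 a≤b)

2[1+m]∸[1+2a]≡2[m∸a]+1 : ∀ m a → a ≤ m → 2 * suc m ∸ suc (2 * a) ≡ 2 * (m ∸ a) + 1
2[1+m]∸[1+2a]≡2[m∸a]+1 m zero _ = trans (cong (_∸ 1) (*-suc 2 m)) (+-comm 1 (2 * m))
2[1+m]∸[1+2a]≡2[m∸a]+1 (suc m) (suc a) (s≤s a≤m) =
  trans (cong₂ (λ u v → u ∸ suc v) (*-suc 2 (suc m)) (*-suc 2 a)) (2[1+m]∸[1+2a]≡2[m∸a]+1 m a a≤m)

2[1+m]∸[2+2a]≡2[m∸a] : ∀ m a → a ≤ m → 2 * suc m ∸ suc (2 * a + 1) ≡ 2 * (m ∸ a)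
2[1+m]∸[2+2a]≡2[m∸a] m zero _ = cong (_∸ 2) (*-suc 2 m)
2[1+m]∸[2+2a]≡2[m∸a] (suc m) (suc a) (s≤s a≤m) =
  trans (cong₂ (λ u v → u ∸ suc (v + 1)) (*-suc 2 (suc m)) (*-suc 2 a)) (2[1+m]∸[2+2a]≡2[m∸a] m a a≤m)

2a≢2b+1 : ∀ a b → 2 * a ≢ 2 * b + 1
2a≢2b+1 a b eq = even≢odd a b (trans eq (+-comm (2 * b) 1))

1+[2b+1]≡2[1+b] : ∀ b → suc (2 * b + 1) ≡ 2 * suc b
1+[2b+1]≡2[1+b] b = trans (cong suc (+-comm (2 * b) 1)) (sym (*-suc 2 b))

y<2b+1⇒y≤2b : ∀ {y b} → y < 2 * b + 1 → y ≤ 2 * b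
y<2b+1⇒y≤2b {y} {b} y<2b+1 = s≤s⁻¹ (subst (y <_) (+-comm (2 * b) 1) y<2b+1)

parity-suc : ∀ k → parity (suc k) ≡ parity k ⁻¹
parity-suc k = trans (sym (⁻¹-involutive (parity (suc k)))) (cong _⁻¹ (suc-homo-⁻¹ k))

-- Whether y ∈ [min a b, max a b): as a xor of two thresholds this makes Closed below an equivalence.
between : ℕ → ℕ → ℕ → Bool
between a b y = does (a ≤? y) xor does (b ≤? y)

module _ {a b y : ℕ} where

  between-inside : a ≤ y → y < b → between a b y ≡ true
  between-inside a≤y y<b = cong₂ _xor_ (dec-true (a ≤? y) a≤y) (dec-false (b ≤? y) (<⇒≱ y<b))

  between-below : y < a → y < b → between a b y ≡ false
  between-below y<a y<b = cong₂ _xor_ (dec-false (a ≤? y) (<⇒≱ y<a)) (dec-false (b ≤? y) (<⇒≱ y<b))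

  between-above : a ≤ y → b ≤ y → between a b y ≡ false
  between-above a≤y b≤y = cong₂ _xor_ (dec-true (a ≤? y) a≤y) (dec-true (b ≤? y) b≤y)

  between⇒ : a ≤ b → between a b y ≡ true → a ≤ y × y < b
  between⇒ a≤b h with y <? a | y <? b
  ... | yes y<a | yes y<b = ⊥-elim (not-¬ h (between-below y<a y<b))
  ... | yes y<a | no y≮b = ⊥-elim (y≮b (<-≤-trans y<a a≤b))
  ... | no y≮a | yes y<b = ≮⇒≥ y≮a , y<b
  ... | no y≮a | no y≮b = ⊥-elim (not-¬ h (between-above (≮⇒≥ y≮a) (≮⇒≥ y≮b)))

between-sym : ∀ a b y → between a b y ≡ between b a y
between-sym a b y = xor-comm (does (a ≤? y)) (does (b ≤? y))

between-trans : ∀ a b c y → between a b y xor between b c y ≡ between a c y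
between-trans a b c y = xor-cancel (does (a ≤? y)) (does (b ≤? y)) (does (c ≤? y))
  where
  xor-cancel : ∀ u v w → (u xor v) xor (v xor w) ≡ u xor w
  xor-cancel u v w = trans (xor-assoc u v (v xor w))
    (cong (u xor_) (trans (sym (xor-assoc v v w)) (cong (_xor w) (xor-same v))))

between-split : ∀ {a b c d} → a ≤ b → b ≤ c → c ≤ d →
  ∀ y → between a b y ≡ between a c y ∧ not (between b d y)
between-split {a} {b} {c} {d} a≤b b≤c c≤d y =
  nested (does (a ≤? y)) (does (b ≤? y)) (does (c ≤? y)) (does (d ≤? y))
         (antitone a≤b) (antitone b≤c) (antitone c≤d)
  where
  false≢true : false ≢ true
  false≢true ()
  antitone : ∀ {u v} → u ≤ v → does (v ≤? y) ≡ true → does (u ≤? y) ≡ true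
  antitone {u} {v} u≤v h = dec-true (u ≤? y) (≤-trans u≤v (dec-true⁻¹ (v ≤? y) h))
  nested : ∀ A B C D → (B ≡ true → A ≡ true) → (C ≡ true → B ≡ true) → (D ≡ true → C ≡ true) →
    A xor B ≡ (A xor C) ∧ not (B xor D)
  nested false false false false _ _ _ = refl
  nested true  false false false _ _ _ = refl
  nested true  true  false false _ _ _ = refl
  nested true  true  true  false _ _ _ = refl
  nested true  true  true  true  _ _ _ = refl
  nested false true  _     _     B⇒A _ _ = ⊥-elim (false≢true (B⇒A refl))
  nested _     false true  _     _ C⇒B _ = ⊥-elim (false≢true (C⇒B refl))
  nested _     _     false true  _ _ D⇒C = ⊥-elim (false≢true (D⇒C refl))

IsSymmetricM-resp-EqM : ∀ {n} {M M′ : ArchRel n} → EqM n M M′ → IsSymmetricM n M′ → IsSymmetricM n M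
IsSymmetricM-resp-EqM M≐M′ symm p q =
  (λ Mpq → proj₂ (M≐M′ _ _) (proj₁ (symm p q) (proj₁ (M≐M′ p q) Mpq))) ,
  (λ Mpq → proj₂ (M≐M′ p q) (proj₂ (symm p q) (proj₁ (M≐M′ _ _) Mpq)))

module NoncrossingMatching {n} {M : ArchRel n} (isC : IsC n M) where

  M-sym : ∀ {p q} → M p q → M q p
  M-sym = proj₁ (proj₁ isC) _ _

  π : Fin (2 * n) → Fin (2 * n)
  π p = proj₁ (proj₂ (proj₂ (proj₁ isC)) p)

  M-π : ∀ p → M p (π p)
  M-π p = proj₁ (proj₂ (proj₂ (proj₂ (proj₁ isC)) p))

  M⇒≡π : ∀ {p q} → M p q → q ≡ π p
  M⇒≡π {p} = proj₂ (proj₂ (proj₂ (proj₂ (proj₁ isC)) p)) _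

  π-involutive : ∀ p → π (π p) ≡ p
  π-involutive p = sym (M⇒≡π (M-sym (M-π p)))

  π-injective : ∀ {p q} → π p ≡ π q → p ≡ q
  π-injective {p} {q} eq = trans (sym (π-involutive p)) (trans (cong π eq) (π-involutive q))

  π-irreflexive : ∀ p → π p ≢ p
  π-irreflexive p eq = proj₁ (proj₂ (proj₁ isC)) p (π p) (M-π p) (sym eq)

  π-inside : ∀ {a x} → toℕ a < toℕ x → toℕ x < toℕ (π a) →
    toℕ a < toℕ (π x) × toℕ (π x) < toℕ (π a)
  π-inside {a} {x} a<x x<πa with <-cmp (toℕ (π x)) (toℕ a)
  ... | tri< πx<a _ _ = ⊥-elim (proj₂ isC (π x) a x (π a) πx<a a<x x<πa (M-sym (M-π x) , M-π a))
  ... | tri≈ _ πx≡a _ =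
    ⊥-elim (<-irrefl (cong toℕ (trans (sym (π-involutive x)) (cong π (toℕ-injective πx≡a)))) x<πa)
  ... | tri> _ _ a<πx with <-cmp (toℕ (π x)) (toℕ (π a))
  ...   | tri< πx<πa _ _ = a<πx , πx<πa
  ...   | tri≈ _ πx≡πa _ = ⊥-elim (<-irrefl (cong toℕ (π-injective (toℕ-injective (sym πx≡πa)))) a<x)
  ...   | tri> _ _ πa<πx = ⊥-elim (proj₂ isC a x (π a) (π x) a<x x<πa πa<πx (M-π a , M-π x))

  -- The interval [a, b) of positions is a union of arches.
  record Closed (a b : ℕ) : Set where
    constructor mkClosed
    field π-stable : ∀ x → between a b (toℕ (π x)) ≡ between a b (toℕ x)
  open Closed public

  Closed? : ∀ a b → Dec (Closed a b)
  Closed? a b = map′ mkClosed π-stable (all? λ x → between a b (toℕ (π x)) ≟ᵇ between a b (toℕ x))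

  Closed-refl : ∀ a → Closed a a
  Closed-refl a = mkClosed λ x → trans (xor-same (does (a ≤? toℕ (π x)))) (sym (xor-same (does (a ≤? toℕ x))))

  Closed-sym : ∀ {a b} → Closed a b → Closed b a
  Closed-sym {a} {b} ab = mkClosed λ x → trans (between-sym b a _) (trans (π-stable ab x) (between-sym a b _))

  Closed-trans : ∀ {a b c} → Closed a b → Closed b c → Closed a c
  Closed-trans {a} {b} {c} ab bc = mkClosed λ x →
    trans (sym (between-trans a b c _)) (trans (cong₂ _xor_ (π-stable ab x) (π-stable bc x)) (between-trans a b c _))

  Closed-whole : Closed 0 (2 * n)
  Closed-whole = mkClosed λ x → trans (between-inside z≤n (toℕ<n (π x))) (sym (between-inside z≤n (toℕ<n x)))

  closed-elim : ∀ {a b x} → Closed a b → a ≤ b → a ≤ toℕ x → toℕ x < b →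
    a ≤ toℕ (π x) × toℕ (π x) < b
  closed-elim {x = x} cl a≤b a≤x x<b = between⇒ a≤b (trans (π-stable cl x) (between-inside a≤x x<b))

  closed-intro : ∀ {a b} → a ≤ b →
    (∀ x → a ≤ toℕ x → toℕ x < b → a ≤ toℕ (π x) × toℕ (π x) < b) → Closed a b
  closed-intro {a} {b} a≤b stays = mkClosed λ x → ≡true⇔⇒≡
    (λ h → subst (λ z → between a b (toℕ z) ≡ true) (π-involutive x) (moves (π x) h)) (moves x)
    where
    moves : ∀ y → between a b (toℕ y) ≡ true → between a b (toℕ (π y)) ≡ true
    moves y h = let a≤y , y<b = between⇒ a≤b h ; a≤πy , πy<b = stays y a≤y y<b in
                between-inside a≤πy πy<b

  arch-interior-closed : ∀ {x} → toℕ x < toℕ (π x) → Closed (suc (toℕ x)) (toℕ (π x))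
  arch-interior-closed x<πx = closed-intro x<πx λ _ → π-inside

  arch-closed : ∀ {x} → toℕ x < toℕ (π x) → Closed (toℕ x) (suc (toℕ (π x)))
  arch-closed {x} x<πx = closed-intro (m≤n⇒m≤1+n (<⇒≤ x<πx)) stays
    where
    stays : ∀ y → toℕ x ≤ toℕ y → toℕ y < suc (toℕ (π x)) →
      toℕ x ≤ toℕ (π y) × toℕ (π y) < suc (toℕ (π x))
    stays y x≤y y≤πx with m≤n⇒m<n∨m≡n x≤y | m≤n⇒m<n∨m≡n (s≤s⁻¹ y≤πx)
    ... | inj₂ x≡y | _ rewrite toℕ-injective x≡y = <⇒≤ x<πx , ≤-refl
    ... | inj₁ _ | inj₂ y≡πx rewrite toℕ-injective y≡πx | π-involutive x = ≤-refl , m≤n⇒m≤1+n x<πx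
    ... | inj₁ x<y | inj₁ y<πx = let x<πy , πy<πx = π-inside x<y y<πx in <⇒≤ x<πy , m≤n⇒m≤1+n πy<πx

  -- The arch starting at a splits [a, b) into two shorter unions of arches.
  closed⇒≡parity : ∀ {a b} → a ≤ b → b ≤ 2 * n → Closed a b → parity a ≡ parity b
  closed⇒≡parity {a} {b} = go b (m≤m+n b a)
    where
    go : ∀ fuel {a b} → b ≤ fuel + a → a ≤ b → b ≤ 2 * n → Closed a b → parity a ≡ parity b
    go fuel _ a≤b _ _ with m≤n⇒m<n∨m≡n a≤b
    ... | inj₂ refl = refl
    go zero b≤a _ _ _ | inj₁ a<b = ⊥-elim (<⇒≱ a<b b≤a)
    go (suc f) {a} {b} b≤1+f+a a≤b b≤2n cl | inj₁ a<b = begin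
      parity a          ≡⟨ sym (suc-homo-⁻¹ a) ⟩
      parity (suc a) ⁻¹ ≡⟨ cong _⁻¹ (go f c≤f+1+a a<c (<⇒≤ (<-≤-trans c<b b≤2n)) inner) ⟩
      parity c ⁻¹       ≡⟨ sym (parity-suc c) ⟩
      parity (suc c)    ≡⟨ go f b≤f+1+c c<b b≤2n outer ⟩
      parity b          ∎
      where
      x : Fin (2 * n)
      x = fromℕ< (<-≤-trans a<b b≤2n)
      x≡a : toℕ x ≡ a
      x≡a = toℕ-fromℕ< _
      c : ℕ
      c = toℕ (π x)
      a≤c×c<b : a ≤ c × c < b
      a≤c×c<b = closed-elim cl a≤b (≤-reflexive (sym x≡a)) (subst (_< b) (sym x≡a) a<b)
      c<b : c < b
      c<b = proj₂ a≤c×c<b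
      x<πx : toℕ x < c
      x<πx = ≤∧≢⇒< (subst (_≤ c) (sym x≡a) (proj₁ a≤c×c<b))
                   (λ x≡c → π-irreflexive x (toℕ-injective (sym x≡c)))
      a<c : a < c
      a<c = subst (_< c) x≡a x<πx
      inner : Closed (suc a) c
      inner = subst (λ z → Closed (suc z) c) x≡a (arch-interior-closed x<πx)
      outer : Closed (suc c) b
      outer = Closed-trans (Closed-sym (subst (λ z → Closed z (suc c)) x≡a (arch-closed x<πx))) cl
      c≤f+1+a : c ≤ f + suc a
      c≤f+1+a = ≤-trans (s≤s⁻¹ (<-≤-trans c<b b≤1+f+a))
                        (≤-trans (n≤1+n (f + a)) (≤-reflexive (sym (+-suc f a))))
      b≤f+1+c : b ≤ f + suc c
      b≤f+1+c = ≤-trans b≤1+f+a (≤-trans (≤-reflexive (sym (+-suc f a))) (+-monoʳ-≤ f (s≤s (<⇒≤ a<c))))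

  arch-parity : ∀ {x} → toℕ x < toℕ (π x) → parity (suc (toℕ x)) ≡ parity (toℕ (π x))
  arch-parity x<πx = closed⇒≡parity x<πx (<⇒≤ (toℕ<n (π _))) (arch-interior-closed x<πx)

  π-flips-parity : ∀ x → parity (toℕ (π x)) ≡ parity (toℕ x) ⁻¹
  π-flips-parity x with <-cmp (toℕ x) (toℕ (π x))
  ... | tri< x<πx _ _ = trans (sym (arch-parity x<πx)) (parity-suc (toℕ x))
  ... | tri≈ _ x≡πx _ = ⊥-elim (π-irreflexive x (toℕ-injective (sym x≡πx)))
  ... | tri> _ _ πx<x = begin
    parity (toℕ (π x))          ≡⟨ sym (⁻¹-involutive _) ⟩
    parity (toℕ (π x)) ⁻¹ ⁻¹    ≡⟨ cong _⁻¹ (sym (parity-suc (toℕ (π x)))) ⟩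
    parity (suc (toℕ (π x))) ⁻¹ ≡⟨ cong _⁻¹ (arch-parity πx<ππx) ⟩
    parity (toℕ (π (π x))) ⁻¹   ≡⟨ cong (λ y → parity (toℕ y) ⁻¹) (π-involutive x) ⟩
    parity (toℕ x) ⁻¹           ∎
    where
    πx<ππx : toℕ (π x) < toℕ (π (π x))
    πx<ππx = subst (λ y → toℕ (π x) < toℕ y) (sym (π-involutive x)) πx<x

opposite-< : ∀ {k} {p q : Fin k} → toℕ p < toℕ q → toℕ (opposite q) < toℕ (opposite p)
opposite-< {p = p} {q} p<q =
  subst₂ _<_ (sym (opposite-prop q)) (sym (opposite-prop p)) (∸-monoʳ-< (s≤s p<q) (toℕ<n q))

CyclicallyBetween : ℕ → ℕ → ℕ → Set
CyclicallyBetween x y z = (x < y × y < z) ⊎ (y < z × z < x) ⊎ (z < x × x < y)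

CyclicallyBetween-opposite : ∀ {k} {x y z : Fin k} → CyclicallyBetween (toℕ x) (toℕ y) (toℕ z) →
  CyclicallyBetween (toℕ (opposite z)) (toℕ (opposite y)) (toℕ (opposite x))
CyclicallyBetween-opposite (inj₁ (x<y , y<z)) = inj₁ (opposite-< y<z , opposite-< x<y)
CyclicallyBetween-opposite (inj₂ (inj₁ (y<z , z<x))) = inj₂ (inj₂ (opposite-< z<x , opposite-< y<z))
CyclicallyBetween-opposite (inj₂ (inj₂ (z<x , x<y))) = inj₂ (inj₁ (opposite-< x<y , opposite-< z<x))

module Points (m : ℕ) where

  Label : Set
  Label = Fin (suc m)

  Position : Set
  Position = Fin (2 * suc m)

  -- Position 2i is the point i, and position end j the point (j−1)′ (with 0′ = n′) at which Ψ ends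
  -- the arch leaving towards j.
  end : Label → ℕ
  end j = 2 * prevℕ (suc m) (toℕ j) + 1

  prev≤m : ∀ (j : Label) → prevℕ (suc m) (toℕ j) ≤ m
  prev≤m zero = ≤-refl
  prev≤m (suc j) = <⇒≤ (toℕ<n j)

  pos : Label → Position
  pos i = fromℕ< (*-monoʳ-< 2 (toℕ<n i))

  pos′ : Label → Position
  pos′ j = fromℕ< (b<a⇒2b+1<2a (s≤s (prev≤m j)))

  toℕ-pos : ∀ i → toℕ (pos i) ≡ 2 * toℕ i
  toℕ-pos i = toℕ-fromℕ< _

  toℕ-pos′ : ∀ j → toℕ (pos′ j) ≡ end j
  toℕ-pos′ j = toℕ-fromℕ< _

  -- The unique l such that p is the point l or the point (l−1)′.
  label : Position → Label
  label p = ⌈ toℕ p /2⌉ mod suc m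

  toℕ-label : ∀ (p : Position) → toℕ p ≤ 2 * m → toℕ (label p) ≡ ⌈ toℕ p /2⌉
  toℕ-label p p≤2m = trans (toℕ-fromℕ< _) (m≤n⇒m%n≡m (y≤2b⇒⌈y/2⌉≤b p≤2m))

  label-last : ∀ (p : Position) → toℕ p ≡ 2 * m + 1 → label p ≡ zero
  label-last p p≡2m+1 = toℕ-injective (trans (toℕ-fromℕ< _)
    (trans (cong (λ y → ⌈ y /2⌉ % suc m) p≡2m+1) (trans (cong (_% suc m) (⌈2h+1/2⌉≡1+h m)) (n%n≡0 (suc m)))))

  label-pos : ∀ (p : Position) {i} → toℕ p ≡ 2 * toℕ i → label p ≡ i
  label-pos p {i} p≡2i =
    toℕ-injective (trans (toℕ-label p p≤2m) (trans (cong ⌈_/2⌉ p≡2i) (⌈2h/2⌉≡h (toℕ i))))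
    where
    p≤2m : toℕ p ≤ 2 * m
    p≤2m = subst (_≤ 2 * m) (sym p≡2i) (*-monoʳ-≤ 2 (s≤s⁻¹ (toℕ<n i)))

  label-pos′ : ∀ (p : Position) {j} → toℕ p ≡ end j → label p ≡ j
  label-pos′ p {zero} p≡2m+1 = label-last p p≡2m+1
  label-pos′ p {suc j} p≡2j+1 =
    toℕ-injective (trans (toℕ-label p p≤2m) (trans (cong ⌈_/2⌉ p≡2j+1) (⌈2h+1/2⌉≡1+h (toℕ j))))
    where
    p≤2m : toℕ p ≤ 2 * m
    p≤2m = subst (_≤ 2 * m) (sym p≡2j+1) (<⇒≤ (b<a⇒2b+1<2a (toℕ<n j)))

  <-label : ∀ (p : Position) {a} → 2 * a < toℕ p → toℕ p ≤ 2 * m → a < toℕ (label p)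
  <-label p 2a<p p≤2m = subst (_ <_) (sym (toℕ-label p p≤2m)) (2a<y⇒a<⌈y/2⌉ 2a<p)

  label-≤ : ∀ (p : Position) {b} → toℕ p ≤ 2 * b → b ≤ m → toℕ (label p) ≤ b
  label-≤ p p≤2b b≤m =
    subst (_≤ _) (sym (toℕ-label p (≤-trans p≤2b (*-monoʳ-≤ 2 b≤m)))) (y≤2b⇒⌈y/2⌉≤b p≤2b)

  label-mono : ∀ (p q : Position) → toℕ p ≤ toℕ q → toℕ q ≤ 2 * m → toℕ (label p) ≤ toℕ (label q)
  label-mono p q p≤q q≤2m =
    subst₂ _≤_ (sym (toℕ-label p (≤-trans p≤q q≤2m))) (sym (toℕ-label q q≤2m)) (⌈n/2⌉-mono p≤q)

  position-view : ∀ (p : Position) → (parity (toℕ p) ≡ 0ℙ × toℕ p ≡ 2 * toℕ (label p))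
                      ⊎ (parity (toℕ p) ≡ 1ℙ × toℕ p ≡ end (label p))
  position-view p with even-or-odd (toℕ p)
  ... | inj₁ (h , p≡2h) = inj₁ (trans (cong parity p≡2h) (parity-even h) ,
        trans p≡2h (cong (2 *_) (sym (trans (toℕ-label p p≤2m) (trans (cong ⌈_/2⌉ p≡2h) (⌈2h/2⌉≡h h))))))
    where
    p≤2m : toℕ p ≤ 2 * m
    p≤2m = subst (_≤ 2 * m) (sym p≡2h)
      (*-monoʳ-≤ 2 (s≤s⁻¹ (*-cancelˡ-< 2 h (suc m) (subst (_< 2 * suc m) p≡2h (toℕ<n p)))))
  ... | inj₂ (h , p≡2h+1) = inj₂ (trans (cong parity p≡2h+1) (parity-odd h) , odd-end)
    where
    h<1+m : h < suc m
    h<1+m = 2b+1<2a⇒b<a (subst (_< 2 * suc m) p≡2h+1 (toℕ<n p))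
    odd-end : toℕ p ≡ end (label p)
    odd-end with m≤n⇒m<n∨m≡n (s≤s⁻¹ h<1+m)
    ... | inj₂ refl = subst (λ j → toℕ p ≡ end j) (sym (label-last p p≡2h+1)) p≡2h+1
    ... | inj₁ h<m = subst (λ j → toℕ p ≡ end j) (sym (label-pos′ p {suc (fromℕ< h<m)} p≡end)) p≡end
      where
      p≡end : toℕ p ≡ end (suc (fromℕ< h<m))
      p≡end = trans p≡2h+1 (cong (λ y → 2 * y + 1) (sym (toℕ-fromℕ< h<m)))

  σ : Label → Label
  σ zero = zero
  σ (suc x) = suc (opposite x)

  toℕ-σ : ∀ i → toℕ (σ i) ≡ σℕ (suc m) (toℕ i)
  toℕ-σ zero = refl
  toℕ-σ (suc x) = trans (cong suc (opposite-prop x)) (sym (+-∸-assoc 1 (toℕ<n x)))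

  σ-involutive : ∀ i → σ (σ i) ≡ i
  σ-involutive zero = refl
  σ-involutive (suc x) = cong suc (opposite-involutive x)

  opposite-pos : ∀ (p : Position) i → toℕ p ≡ 2 * toℕ i → toℕ (opposite p) ≡ end (σ i)
  opposite-pos p i p≡2i = begin
    toℕ (opposite p)            ≡⟨ opposite-prop p ⟩
    2 * suc m ∸ suc (toℕ p)     ≡⟨ cong (λ y → 2 * suc m ∸ suc y) p≡2i ⟩
    2 * suc m ∸ suc (2 * toℕ i) ≡⟨ 2[1+m]∸[1+2a]≡2[m∸a]+1 m (toℕ i) (s≤s⁻¹ (toℕ<n i)) ⟩
    2 * (m ∸ toℕ i) + 1         ≡⟨ cong (λ y → 2 * y + 1) (prev-σ i) ⟩
    end (σ i)                   ∎
    where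
    prev-σ : ∀ i → m ∸ toℕ i ≡ prevℕ (suc m) (toℕ (σ i))
    prev-σ zero = refl
    prev-σ (suc x) = sym (opposite-prop x)

  opposite-pos′ : ∀ (p : Position) j → toℕ p ≡ end j → toℕ (opposite p) ≡ 2 * toℕ (σ j)
  opposite-pos′ p j p≡end = begin
    toℕ (opposite p)                       ≡⟨ opposite-prop p ⟩
    2 * suc m ∸ suc (toℕ p)                ≡⟨ cong (λ y → 2 * suc m ∸ suc y) p≡end ⟩
    2 * suc m ∸ suc (end j)                ≡⟨ 2[1+m]∸[2+2a]≡2[m∸a] m _ (prev≤m j) ⟩
    2 * (m ∸ prevℕ (suc m) (toℕ j))        ≡⟨ cong (2 *_) (σ-prev j) ⟩
    2 * toℕ (σ j)                          ∎
    where
    σ-prev : ∀ j → m ∸ prevℕ (suc m) (toℕ j) ≡ toℕ (σ j)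
    σ-prev zero = n∸n≡0 m
    σ-prev (suc x) = sym (toℕ-σ (suc x))

  label-opposite : ∀ (p : Position) → label (opposite p) ≡ σ (label p)
  label-opposite p with position-view p
  ... | inj₁ (_ , p≡2l) = label-pos′ (opposite p) (opposite-pos p (label p) p≡2l)
  ... | inj₂ (_ , p≡end) = label-pos (opposite p) (opposite-pos′ p (label p) p≡end)

  last-or-≤2m : ∀ (p : Position) → toℕ p ≡ 2 * m + 1 ⊎ toℕ p ≤ 2 * m
  last-or-≤2m p with m≤n⇒m<n∨m≡n (s≤s⁻¹ (subst (toℕ p <_) (*-suc 2 m) (toℕ<n p)))
  ... | inj₁ p<1+2m = inj₂ (s≤s⁻¹ p<1+2m)
  ... | inj₂ p≡1+2m = inj₁ (trans p≡1+2m (+-comm 1 (2 * m)))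

  even≢end : ∀ (i j : Label) → 2 * toℕ i ≢ end j
  even≢end i j = 2a≢2b+1 (toℕ i) (prevℕ (suc m) (toℕ j))

  -- p lies strictly inside the arc running from the point i rightwards to the point (j−1)′, wrapping
  -- around the end of the line.
  OnArc : Label → Label → Position → Set
  OnArc i j p = CyclicallyBetween (2 * toℕ i) (toℕ p) (end j)

  ArcFree : BlockRel (suc m) → Label → Label → Set
  ArcFree R i j = ∀ p → OnArc i j p → R i (label p) ≡ false

  module _ (R : BlockRel (suc m)) where

    CycPair⇒ArcFree : ∀ {i j} → CycPair R i j → ArcFree R i j
    CycPair⇒ArcFree {i} {zero} (inj₁ (() , _))
    CycPair⇒ArcFree {i} {suc j} (inj₁ (i<j , _ , gap)) p (inj₁ (2i<p , p<e)) =
      gap (label p) (<-label p 2i<p (≤-trans p≤2j (*-monoʳ-≤ 2 (<⇒≤ (toℕ<n j)))))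
                    (s≤s (label-≤ p p≤2j (<⇒≤ (toℕ<n j))))
      where
      p≤2j : toℕ p ≤ 2 * toℕ j
      p≤2j = y<2b+1⇒y≤2b {b = toℕ j} p<e
    CycPair⇒ArcFree {i} {suc j} (inj₁ (i<j , _ , _)) p (inj₂ (inj₁ (_ , e<2i))) =
      ⊥-elim (<⇒≱ (2b+1<2a⇒b<a e<2i) (s≤s⁻¹ i<j))
    CycPair⇒ArcFree {i} {suc j} (inj₁ (i<j , _ , _)) p (inj₂ (inj₂ (e<2i , _))) =
      ⊥-elim (<⇒≱ (2b+1<2a⇒b<a e<2i) (s≤s⁻¹ i<j))
    CycPair⇒ArcFree {i} {zero} (inj₂ (_ , _ , max)) p (inj₁ (2i<p , p<e)) =
      ¬-not λ Ril → <⇒≱ (<-label p 2i<p (y<2b+1⇒y≤2b {b = m} p<e)) (max (label p) Ril)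
    CycPair⇒ArcFree {i} {zero} (inj₂ _) p (inj₂ (inj₁ (_ , e<2i))) =
      ⊥-elim (<⇒≱ (2b+1<2a⇒b<a e<2i) (s≤s⁻¹ (toℕ<n i)))
    CycPair⇒ArcFree {i} {zero} (inj₂ _) p (inj₂ (inj₂ (e<2i , _))) =
      ⊥-elim (<⇒≱ (2b+1<2a⇒b<a e<2i) (s≤s⁻¹ (toℕ<n i)))
    CycPair⇒ArcFree {i} {suc j} (inj₂ (_ , min , _)) p (inj₁ (_ , p<e)) =
      ¬-not λ Ril →
        <⇒≱ (s≤s (label-≤ p (y<2b+1⇒y≤2b {b = toℕ j} p<e) (<⇒≤ (toℕ<n j)))) (min (label p) Ril)
    CycPair⇒ArcFree {i} {suc j} (inj₂ (_ , min , _)) p (inj₂ (inj₁ (p<e , _))) =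
      ¬-not λ Ril →
        <⇒≱ (s≤s (label-≤ p (y<2b+1⇒y≤2b {b = toℕ j} p<e) (<⇒≤ (toℕ<n j)))) (min (label p) Ril)
    CycPair⇒ArcFree {i} {suc j} (inj₂ (_ , min , max)) p (inj₂ (inj₂ (_ , 2i<p))) with last-or-≤2m p
    ... | inj₁ p≡last =
      ¬-not λ Ril → <⇒≱ z<s (min zero (subst (λ l → R i l ≡ true) (label-last p p≡last) Ril))
    ... | inj₂ p≤2m = ¬-not λ Ril → <⇒≱ (<-label p 2i<p p≤2m) (max (label p) Ril)

    ArcFree⇒∉ : ∀ {i j} → ArcFree R i j → ∀ k →
      CyclicallyBetween (2 * toℕ i) (2 * toℕ k) (end j) → R i k ≡ false
    ArcFree⇒∉ {i} free k arc = subst (λ l → R i l ≡ false) (label-pos (pos k) (toℕ-pos k))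
      (free (pos k) (subst (λ y → CyclicallyBetween _ y _) (sym (toℕ-pos k)) arc))

    ArcFree⇒CycPair : ∀ {i j} → R i j ≡ true → ArcFree R i j → CycPair R i j
    ArcFree⇒CycPair {i} {zero} Rij free = inj₂ (Rij , (λ _ _ → z≤n) , λ k Rik → ≮⇒≥ λ i<k →
      not-¬ Rik (ArcFree⇒∉ {j = zero} free k (inj₁ (*-monoʳ-< 2 i<k , a≤b⇒2a<2b+1 (s≤s⁻¹ (toℕ<n k))))))
    ArcFree⇒CycPair {i} {suc j} Rij free with toℕ i ≤? toℕ j
    ... | yes i≤j = inj₁ (s≤s i≤j , Rij , λ k i<k k<j →
          ArcFree⇒∉ {j = suc j} free k (inj₁ (*-monoʳ-< 2 i<k , a≤b⇒2a<2b+1 (s≤s⁻¹ k<j))))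
    ... | no i≰j = inj₂ (Rij ,
          (λ k Rik → ≮⇒≥ λ k<j → not-¬ Rik (ArcFree⇒∉ {j = suc j} free k
            (inj₂ (inj₁ (a≤b⇒2a<2b+1 (s≤s⁻¹ k<j) , b<a⇒2b+1<2a (≰⇒> i≰j)))))) ,
          (λ k Rik → ≮⇒≥ λ i<k → not-¬ Rik (ArcFree⇒∉ {j = suc j} free k
            (inj₂ (inj₂ (b<a⇒2b+1<2a (≰⇒> i≰j) , *-monoʳ-< 2 i<k))))))

    PsiArch-labels : ∀ {p q} → PsiArch R p q →
      CycPair R (label p) (label q) × toℕ p ≡ 2 * toℕ (label p) × toℕ q ≡ end (label q)
    PsiArch-labels {p} {q} (i , j , c , p≡2i , q≡end) rewrite label-pos p p≡2i | label-pos′ q {j} q≡end =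
      c , p≡2i , q≡end

    Ψ-arch : ∀ {i j} → CycPair R i j → Ψ (suc m) R (pos i) (pos′ j)
    Ψ-arch {i} {j} c = inj₁ (i , j , c , toℕ-pos i , toℕ-pos′ j)

    Ψ-arch⁻¹ : ∀ {p q i j} → Ψ (suc m) R p q → toℕ p ≡ 2 * toℕ i → toℕ q ≡ end j → CycPair R i j
    Ψ-arch⁻¹ {p} {q} {i} {j} (inj₁ arch) p≡2i q≡end =
      subst₂ (CycPair R) (label-pos p p≡2i) (label-pos′ q q≡end) (proj₁ (PsiArch-labels arch))
    Ψ-arch⁻¹ {i = i} (inj₂ (_ , j′ , _ , _ , p≡end)) p≡2i _ =
      ⊥-elim (even≢end i j′ (trans (sym p≡2i) p≡end))

    Ψ-sym : ∀ {p q} → Ψ (suc m) R p q → Ψ (suc m) R q p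
    Ψ-sym (inj₁ arch) = inj₂ arch
    Ψ-sym (inj₂ arch) = inj₁ arch

    Ψ-opposite : (∀ {i j} → CycPair R i j → CycPair R (σ j) (σ i)) →
      ∀ {p q} → Ψ (suc m) R p q → Ψ (suc m) R (opposite p) (opposite q)
    Ψ-opposite σ-closed {p} {q} (inj₁ (i , j , c , p≡2i , q≡end)) =
      inj₂ (σ j , σ i , σ-closed c , opposite-pos′ q j q≡end , opposite-pos p i p≡2i)
    Ψ-opposite σ-closed {p} {q} (inj₂ (i , j , c , q≡2i , p≡end)) =
      inj₁ (σ j , σ i , σ-closed c , opposite-pos′ p j p≡end , opposite-pos q i q≡2i)

    CycPair-σ-closed⇒Ψ-symmetric : (∀ {i j} → CycPair R i j → CycPair R (σ j) (σ i)) →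
      IsSymmetricM (suc m) (Ψ (suc m) R)
    CycPair-σ-closed⇒Ψ-symmetric σ-closed p q = Ψ-opposite σ-closed , λ Ψpq →
      subst₂ (Ψ (suc m) R) (opposite-involutive p) (opposite-involutive q) (Ψ-opposite σ-closed Ψpq)

    Ψ-symmetric⇒CycPair-σ-closed : IsSymmetricM (suc m) (Ψ (suc m) R) →
      ∀ {i j} → CycPair R i j → CycPair R (σ j) (σ i)
    Ψ-symmetric⇒CycPair-σ-closed Ψ-sym-opp {i} {j} c =
      Ψ-arch⁻¹ (Ψ-sym (proj₁ (Ψ-sym-opp (pos i) (pos′ j)) (Ψ-arch c)))
        (opposite-pos′ (pos′ j) j (toℕ-pos′ j)) (opposite-pos (pos i) i (toℕ-pos i))

  module _ {R : BlockRel (suc m)} (isP : IsPartition R) where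
    open Blocks isP

    Ψ-irreflexive : ∀ p q → Ψ (suc m) R p q → p ≢ q
    Ψ-irreflexive p .p (inj₁ (i , j , _ , p≡2i , p≡end)) refl = even≢end i j (trans (sym p≡2i) p≡end)
    Ψ-irreflexive p .p (inj₂ (i , j , _ , p≡2i , p≡end)) refl = even≢end i j (trans (sym p≡2i) p≡end)

    Ψ-partner : ∀ p → ∃[ q ] (Ψ (suc m) R p q × (∀ q′ → Ψ (suc m) R p q′ → q′ ≡ q))
    Ψ-partner p with position-view p
    ... | inj₁ (_ , p≡2l) with cycSucc (label p)
    ...   | j , c = pos′ j , inj₁ (label p , j , c , p≡2l , toℕ-pos′ j) , unique
      where
      unique : ∀ q′ → Ψ (suc m) R p q′ → q′ ≡ pos′ j
      unique q′ (inj₁ arch) = let c′ , _ , q′≡end = PsiArch-labels R arch in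
        toℕ-injective (trans q′≡end (trans (cong end (CycPair-functional {R = R} c′ c)) (sym (toℕ-pos′ j))))
      unique q′ (inj₂ arch) = let _ , _ , p≡end = PsiArch-labels R arch in
        ⊥-elim (even≢end (label p) (label p) (trans (sym p≡2l) p≡end))
    Ψ-partner p | inj₂ (_ , p≡end) with cycPred (label p)
    ...   | i , c = pos i , inj₂ (i , label p , c , toℕ-pos i , p≡end) , unique
      where
      unique : ∀ q′ → Ψ (suc m) R p q′ → q′ ≡ pos i
      unique q′ (inj₁ arch) = let _ , p≡2l , _ = PsiArch-labels R arch in
        ⊥-elim (even≢end (label p) (label p) (trans (sym p≡2l) p≡end))
      unique q′ (inj₂ arch) = let c′ , q′≡2l , _ = PsiArch-labels R arch in
        toℕ-injective (trans q′≡2l (trans (cong (λ l → 2 * toℕ l) (CycPair-injective c′ c)) (sym (toℕ-pos i))))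

    Ψ-isPerfectMatching : IsPerfectMatching (suc m) (Ψ (suc m) R)
    Ψ-isPerfectMatching = (λ _ _ → Ψ-sym R) , Ψ-irreflexive , Ψ-partner

    Ψ⇒R : ∀ {p q} → Ψ (suc m) R p q → R (label p) (label q) ≡ true
    Ψ⇒R (inj₁ arch) = CycPair⇒R {R = R} (proj₁ (PsiArch-labels R arch))
    Ψ⇒R (inj₂ arch) = R-sym (CycPair⇒R {R = R} (proj₁ (PsiArch-labels R arch)))

    separate-blocks : ∀ {x y x′ y′} → R x y ≡ false → R x x′ ≡ true → R y y′ ≡ true →
      toℕ x′ ≢ toℕ y′
    separate-blocks {y = y} Rxy Rxx′ Ryy′ x′≡y′ =
      not-¬ (R-trans Rxx′ (subst (λ z → R z y ≡ true) (sym (toℕ-injective x′≡y′)) (R-sym Ryy′))) Rxy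

    module _ {a b c d : Position} (a<b : toℕ a < toℕ b) (b<c : toℕ b < toℕ c) (c<d : toℕ c < toℕ d)
             (Ψac : Ψ (suc m) R a c) (Ψbd : Ψ (suc m) R b d) where

      arches-of-one-block-do-not-cross : R (label a) (label b) ≡ true → ⊥
      arches-of-one-block-do-not-cross Rab = split Ψac
        where
        split : Ψ (suc m) R a c → ⊥
        split (inj₁ arch) = let cyc , a≡ , c≡ = PsiArch-labels R arch in
          not-¬ Rab (CycPair⇒ArcFree R cyc b (inj₁ (subst (_< toℕ b) a≡ a<b , subst (toℕ b <_) c≡ b<c)))
        split (inj₂ arch) = let cyc , c≡ , a≡ = PsiArch-labels R arch in
          not-¬ (R-trans (CycPair⇒R {R = R} cyc) (R-trans Rab (Ψ⇒R Ψbd)))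
                (CycPair⇒ArcFree R cyc d
                  (inj₂ (inj₂ (subst₂ _<_ a≡ c≡ (<-trans a<b b<c) , subst (_< toℕ d) c≡ c<d))))

      private
        Rac : R (label a) (label c) ≡ true
        Rac = Ψ⇒R Ψac
        Rbd : R (label b) (label d) ≡ true
        Rbd = Ψ⇒R Ψbd

        -- label is monotone except at the last position, the point 0′ = n′, whose label is 0.
        labels-increase : R (label a) (label b) ≡ false → toℕ c ≤ 2 * m →
          toℕ (label a) < toℕ (label b) × toℕ (label b) < toℕ (label c)
        labels-increase Rab c≤2m =
          ≤∧≢⇒< (label-mono a b (<⇒≤ a<b) (≤-trans (<⇒≤ b<c) c≤2m))
                (separate-blocks Rab (R-refl (label a)) (R-refl (label b))) ,
          ≤∧≢⇒< (label-mono b c (<⇒≤ b<c) c≤2m) (≢-sym (separate-blocks Rab Rac (R-refl (label b))))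

      arches-of-two-blocks-do-not-cross : NonCrossingP R → R (label a) (label b) ≡ false → ⊥
      arches-of-two-blocks-do-not-cross nc Rab with last-or-≤2m d
      ... | inj₂ d≤2m = let la<lb , lb<lc = labels-increase Rab (≤-trans (<⇒≤ c<d) d≤2m) in
        nc (label a) (label b) (label c) (label d) la<lb lb<lc
           (≤∧≢⇒< (label-mono c d (<⇒≤ c<d) d≤2m) (separate-blocks Rab Rac Rbd)) (Rac , Rbd , Rab)
      ... | inj₁ d≡last =
        let la<lb , lb<lc = labels-increase Rab (y<2b+1⇒y≤2b {b = m} (subst (toℕ c <_) d≡last c<d)) in
        nc zero (label a) (label b) (label c) 0<la la<lb lb<lc (R0b , Rac , R0a)
        where
        ld≡0 : label d ≡ zero
        ld≡0 = label-last d d≡last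
        R0b : R zero (label b) ≡ true
        R0b = subst (λ l → R l (label b) ≡ true) ld≡0 (R-sym Rbd)
        0<la : 0 < toℕ (label a)
        0<la = ≤∧≢⇒< z≤n λ 0≡la →
          separate-blocks Rab (R-refl (label a)) Rbd (trans (sym 0≡la) (cong toℕ (sym ld≡0)))
        R0a : R zero (label a) ≡ false
        R0a = ¬-not λ R0la → not-¬ (R-trans (R-sym R0la) R0b) Rab

    Ψ-noncrossing : NonCrossingP R → NonCrossingM (suc m) (Ψ (suc m) R)
    Ψ-noncrossing nc a b c d a<b b<c c<d (Ψac , Ψbd) with R (label a) (label b) in Rab
    ... | true = arches-of-one-block-do-not-cross a<b b<c c<d Ψac Ψbd Rab
    ... | false = arches-of-two-blocks-do-not-cross a<b b<c c<d Ψac Ψbd nc Rab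

    -- Reflecting the line maps the arc from i to (j−1)′ onto the arc from σ j to (σ i − 1)′.
    CycPair-σ : ∀ {Q : BlockRel (suc m)} → (∀ a b → Q (σ a) (σ b) ≡ R a b) →
      ∀ {i j} → CycPair R i j → CycPair Q (σ j) (σ i)
    CycPair-σ {Q} Q∘σ≡R {i} {j} cyc = ArcFree⇒CycPair Q (trans (Q∘σ≡R j i) (R-sym Rij)) free
      where
      Rij : R i j ≡ true
      Rij = CycPair⇒R {R = R} cyc
      free : ArcFree Q (σ j) (σ i)
      free p arc = begin
        Q (σ j) (label p) ≡⟨ cong (Q (σ j)) label-p ⟩
        Q (σ j) (σ l)     ≡⟨ Q∘σ≡R j l ⟩
        R j l             ≡⟨ ¬-not (λ Rjl → not-¬ (R-trans Rij Rjl) Ril) ⟩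
        false             ∎
        where
        l : Label
        l = label (opposite p)
        label-p : label p ≡ σ l
        label-p = trans (cong label (sym (opposite-involutive p))) (label-opposite (opposite p))
        arc′ : OnArc i j (opposite p)
        arc′ = subst₂ (λ u w → CyclicallyBetween u (toℕ (opposite p)) w)
          (trans (cong toℕ (opposite-involutive (pos i))) (toℕ-pos i))
          (trans (cong toℕ (opposite-involutive (pos′ j))) (toℕ-pos′ j))
          (CyclicallyBetween-opposite (subst₂ (λ u w → CyclicallyBetween u (toℕ p) w)
            (sym (opposite-pos′ (pos′ j) j (toℕ-pos′ j))) (sym (opposite-pos (pos i) i (toℕ-pos i))) arc))
        Ril : R i l ≡ false
        Ril = CycPair⇒ArcFree R cyc (opposite p) arc′

  σ-Invariant : BlockRel (suc m) → Set
  σ-Invariant R = ∀ a b → R (σ a) (σ b) ≡ R a b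

  module _ {R : BlockRel (suc m)} (isP : IsPartition R) where
    open Blocks isP

    IsSymmetricP⇒σ-Invariant : IsSymmetricP R → σ-Invariant R
    IsSymmetricP⇒σ-Invariant symm a b = ≡true⇔⇒≡
      (λ h → subst₂ (λ u v → R u v ≡ true) (σ-involutive a) (σ-involutive b) (σ-preserves (σ a) (σ b) h))
      (σ-preserves a b)
      where
      σ-preserves : ∀ a b → R a b ≡ true → R (σ a) (σ b) ≡ true
      σ-preserves a b Rab = let image = proj₂ (symm a) in
        R-trans (R-sym (proj₁ (image (σ a)) (a , R-refl a , toℕ-σ a))) (proj₁ (image (σ b)) (b , Rab , toℕ-σ b))

    σ-Invariant⇒IsSymmetricP : σ-Invariant R → IsSymmetricP R
    σ-Invariant⇒IsSymmetricP inv i = σ i , λ x → into x , out x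
      where
      into : ∀ x → ImageOfBlock R i x → R (σ i) x ≡ true
      into x (j , Rij , x≡σj) = subst (λ y → R (σ i) y ≡ true)
        (toℕ-injective (trans (toℕ-σ j) (sym x≡σj))) (trans (inv i j) Rij)
      out : ∀ x → R (σ i) x ≡ true → ImageOfBlock R i x
      out x Rσix = σ x , subst (λ y → R y (σ x) ≡ true) (σ-involutive i) (trans (inv (σ i) x) Rσix) ,
        trans (cong toℕ (sym (σ-involutive x))) (toℕ-σ (σ x))

    CycPair-σ-closed⇒σ-Invariant : (∀ {i j} → CycPair R i j → CycPair R (σ j) (σ i)) → σ-Invariant R
    CycPair-σ-closed⇒σ-Invariant σ-closed = CycPair⇔⇒≐P isPσ isP from-σ to-σ
      where
      Rσ : BlockRel (suc m)
      Rσ a b = R (σ a) (σ b)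
      isPσ : IsPartition Rσ
      isPσ = (λ i → R-refl (σ i)) , (λ _ _ → R-sym) , (λ _ _ _ → R-trans)
      to-σ : ∀ {i j} → CycPair R i j → CycPair Rσ i j
      to-σ {i} {j} c = subst₂ (CycPair Rσ) (σ-involutive i) (σ-involutive j)
        (CycPair-σ isP {Q = Rσ} (λ a b → cong₂ R (σ-involutive a) (σ-involutive b)) (σ-closed c))
      from-σ : ∀ {i j} → CycPair Rσ i j → CycPair R i j
      from-σ {i} {j} c = subst₂ (CycPair R) (σ-involutive i) (σ-involutive j)
        (σ-closed (CycPair-σ isPσ {Q = R} (λ _ _ → refl) c))

  even-position : ∀ (p : Position) → parity (toℕ p) ≡ 0ℙ → toℕ p ≡ 2 * toℕ (label p)
  even-position p even with position-view p
  ... | inj₁ (_ , p≡2l) = p≡2l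
  ... | inj₂ (odd , _) with () ← trans (sym even) odd

  odd-position : ∀ (p : Position) → parity (toℕ p) ≡ 1ℙ → toℕ p ≡ end (label p)
  odd-position p odd with position-view p
  ... | inj₂ (_ , p≡end) = p≡end
  ... | inj₁ (even , _) with () ← trans (sym even) odd

  module Preimage {M : ArchRel (suc m)} (isC : IsC (suc m) M) where
    open NoncrossingMatching {suc m} isC

    Ψ⁻¹ : BlockRel (suc m)
    Ψ⁻¹ i j = does (Closed? (2 * toℕ i) (2 * toℕ j))

    Ψ⁻¹-closed : ∀ i j → Ψ⁻¹ i j ≡ true → Closed (2 * toℕ i) (2 * toℕ j)
    Ψ⁻¹-closed i j = dec-true⁻¹ (Closed? _ _)

    closed-Ψ⁻¹ : ∀ i j → Closed (2 * toℕ i) (2 * toℕ j) → Ψ⁻¹ i j ≡ true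
    closed-Ψ⁻¹ i j = dec-true (Closed? _ _)

    Ψ⁻¹-isPartition : IsPartition Ψ⁻¹
    Ψ⁻¹-isPartition = (λ i → closed-Ψ⁻¹ i i (Closed-refl _)) ,
      (λ i j h → closed-Ψ⁻¹ j i (Closed-sym (Ψ⁻¹-closed i j h))) ,
      (λ i j k h h′ → closed-Ψ⁻¹ i k (Closed-trans (Ψ⁻¹-closed i j h) (Ψ⁻¹-closed j k h′)))

    Ψ⁻¹-noncrossing : NonCrossingP Ψ⁻¹
    Ψ⁻¹-noncrossing i j k l i<j j<k k<l (Rik , Rjl , Rij) = not-¬ (closed-Ψ⁻¹ i j closed-ij) Rij
      where
      split : ∀ y → between (2 * toℕ i) (2 * toℕ j) y
                  ≡ between (2 * toℕ i) (2 * toℕ k) y ∧ not (between (2 * toℕ j) (2 * toℕ l) y)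
      split = between-split (*-monoʳ-≤ 2 (<⇒≤ i<j)) (*-monoʳ-≤ 2 (<⇒≤ j<k)) (*-monoʳ-≤ 2 (<⇒≤ k<l))
      closed-ij : Closed (2 * toℕ i) (2 * toℕ j)
      closed-ij = mkClosed λ x → trans (split (toℕ (π x)))
        (trans (cong₂ (λ u v → u ∧ not v) (π-stable (Ψ⁻¹-closed i k Rik) x) (π-stable (Ψ⁻¹-closed j l Rjl) x))
               (sym (split (toℕ x))))

    partner-of-even : ∀ x {i : Label} → toℕ x ≡ 2 * toℕ i → toℕ (π x) ≡ end (label (π x))
    partner-of-even x {i} x≡2i = odd-position (π x)
      (trans (π-flips-parity x) (cong _⁻¹ (trans (cong parity x≡2i) (parity-even (toℕ i)))))

    module _ (x : Position) (i : Label) (x≡2i : toℕ x ≡ 2 * toℕ i) where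

      private
        ππx≡2i : toℕ (π (π x)) ≡ 2 * toℕ i
        ππx≡2i = trans (cong toℕ (π-involutive x)) x≡2i

        closed-to : ∀ (j : Label) → toℕ (π x) ≡ end j → Closed (2 * toℕ i) (2 * toℕ j)
        closed-to zero πx≡end = Closed-trans to-end (Closed-sym Closed-whole)
          where
          x<πx : toℕ x < toℕ (π x)
          x<πx = subst₂ _<_ (sym x≡2i) (sym πx≡end) (a≤b⇒2a<2b+1 (s≤s⁻¹ (toℕ<n i)))
          to-end : Closed (2 * toℕ i) (2 * suc m)
          to-end = subst₂ Closed x≡2i (trans (cong suc πx≡end) (1+[2b+1]≡2[1+b] m)) (arch-closed x<πx)
        closed-to (suc j) πx≡end with <-cmp (toℕ x) (toℕ (π x))
        ... | tri< x<πx _ _ =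
          subst₂ Closed x≡2i (trans (cong suc πx≡end) (1+[2b+1]≡2[1+b] (toℕ j))) (arch-closed x<πx)
        ... | tri≈ _ x≡πx _ = ⊥-elim (π-irreflexive x (toℕ-injective (sym x≡πx)))
        ... | tri> _ _ πx<x =
          Closed-sym (subst₂ Closed (trans (cong suc πx≡end) (1+[2b+1]≡2[1+b] (toℕ j))) ππx≡2i
          (arch-interior-closed (subst (toℕ (π x) <_) (sym (cong toℕ (π-involutive x))) πx<x)))

        -- A closed interval between 2i and 2l contains both or neither of x and π x, whereas for a point p
        -- on the arc from i to π x it contains exactly one when l is the label of p.
        x-inside : ∀ (l : Label) → toℕ i < toℕ l → Closed (2 * toℕ i) (2 * toℕ l) →
          2 * toℕ i ≤ toℕ (π x) × toℕ (π x) < 2 * toℕ l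
        x-inside l i<l cl = closed-elim cl (*-monoʳ-≤ 2 (<⇒≤ i<l)) (≤-reflexive (sym x≡2i))
          (subst (_< 2 * toℕ l) (sym x≡2i) (*-monoʳ-< 2 i<l))

        πx-inside : ∀ (l : Label) → 2 * toℕ l ≤ toℕ (π x) → toℕ (π x) < 2 * toℕ i →
          ¬ Closed (2 * toℕ i) (2 * toℕ l)
        πx-inside l 2l≤πx πx<2i cl = <-irrefl ππx≡2i
          (proj₂ (closed-elim (Closed-sym cl) (≤-trans 2l≤πx (<⇒≤ πx<2i)) 2l≤πx πx<2i))

        arc-free : ∀ (j : Label) → toℕ (π x) ≡ end j → ∀ p → OnArc i j p →
          ¬ Closed (2 * toℕ i) (2 * toℕ (label p))
        arc-free j πx≡end p (inj₁ (2i<p , p<e)) cl = <⇒≱ (proj₂ (x-inside (label p) i<l cl))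
          (subst (2 * toℕ (label p) ≤_) (sym πx≡end) (≤-trans (*-monoʳ-≤ 2 l≤k) (m≤m+n _ 1)))
          where
          p≤2k : toℕ p ≤ 2 * prevℕ (suc m) (toℕ j)
          p≤2k = y<2b+1⇒y≤2b {b = prevℕ (suc m) (toℕ j)} p<e
          i<l : toℕ i < toℕ (label p)
          i<l = <-label p 2i<p (≤-trans p≤2k (*-monoʳ-≤ 2 (prev≤m j)))
          l≤k : toℕ (label p) ≤ prevℕ (suc m) (toℕ j)
          l≤k = label-≤ p p≤2k (prev≤m j)
        arc-free j πx≡end p (inj₂ (inj₁ (p<e , e<2i))) = πx-inside (label p)
          (subst (2 * toℕ (label p) ≤_) (sym πx≡end) (≤-trans (*-monoʳ-≤ 2 l≤k) (m≤m+n _ 1)))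
          (subst (_< 2 * toℕ i) (sym πx≡end) e<2i)
          where
          l≤k : toℕ (label p) ≤ prevℕ (suc m) (toℕ j)
          l≤k = label-≤ p (y<2b+1⇒y≤2b {b = prevℕ (suc m) (toℕ j)} p<e) (prev≤m j)
        arc-free j πx≡end p (inj₂ (inj₂ (e<2i , 2i<p))) with last-or-≤2m p
        ... | inj₁ p≡last = subst (λ l → ¬ Closed (2 * toℕ i) (2 * toℕ l)) (sym (label-last p p≡last))
              (πx-inside zero z≤n (subst (_< 2 * toℕ i) (sym πx≡end) e<2i))
        ... | inj₂ p≤2m = λ cl → <⇒≱ (subst (_< 2 * toℕ i) (sym πx≡end) e<2i)
              (proj₁ (x-inside (label p) (<-label p 2i<p p≤2m) cl))

      Ψ⁻¹-partner : CycPair Ψ⁻¹ i (label (π x))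
      Ψ⁻¹-partner = ArcFree⇒CycPair Ψ⁻¹
        (closed-Ψ⁻¹ i (label (π x)) (closed-to (label (π x)) πx≡end))
        (λ p arc → ¬-not λ Ril → arc-free (label (π x)) πx≡end p arc (Ψ⁻¹-closed i (label p) Ril))
        where
        πx≡end : toℕ (π x) ≡ end (label (π x))
        πx≡end = partner-of-even x {i} x≡2i

    PsiArch⇒M : ∀ {p q} → PsiArch Ψ⁻¹ p q → M p q
    PsiArch⇒M {p} {q} (i , j , c , p≡2i , q≡end) = subst (M p) (sym q≡πp) (M-π p)
      where
      q≡πp : q ≡ π p
      q≡πp = toℕ-injective (trans q≡end
        (trans (cong end (CycPair-functional {R = Ψ⁻¹} c (Ψ⁻¹-partner p i p≡2i)))
               (sym (partner-of-even p {i} p≡2i))))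

    M⇒PsiArch : ∀ {p q} → toℕ p ≡ 2 * toℕ (label p) → M p q → PsiArch Ψ⁻¹ p q
    M⇒PsiArch {p} p≡2l Mpq rewrite M⇒≡π Mpq =
      label p , label (π p) , Ψ⁻¹-partner p (label p) p≡2l , p≡2l , partner-of-even p {label p} p≡2l

    Ψ∘Ψ⁻¹ : EqM (suc m) (Ψ (suc m) Ψ⁻¹) M
    Ψ∘Ψ⁻¹ p q = Ψ⇒M , M⇒Ψ
      where
      Ψ⇒M : Ψ (suc m) Ψ⁻¹ p q → M p q
      Ψ⇒M (inj₁ arch) = PsiArch⇒M arch
      Ψ⇒M (inj₂ arch) = M-sym (PsiArch⇒M arch)
      M⇒Ψ : M p q → Ψ (suc m) Ψ⁻¹ p q
      M⇒Ψ Mpq with position-view p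
      ... | inj₁ (_ , p≡2l) = inj₁ (M⇒PsiArch p≡2l Mpq)
      ... | inj₂ (odd , _) = inj₂ (M⇒PsiArch (even-position q q-even) (M-sym Mpq))
        where
        q-even : parity (toℕ q) ≡ 0ℙ
        q-even = trans (cong (λ y → parity (toℕ y)) (M⇒≡π Mpq)) (trans (π-flips-parity p) (cong _⁻¹ odd))

  IsSNC⇒Ψ-IsSC : ∀ {R} → IsSNC R → IsSC (suc m) (Ψ (suc m) R)
  IsSNC⇒Ψ-IsSC {R} ((isP , nc) , symm) = (Ψ-isPerfectMatching isP , Ψ-noncrossing isP nc) ,
    CycPair-σ-closed⇒Ψ-symmetric R (CycPair-σ isP {Q = R} (IsSymmetricP⇒σ-Invariant isP symm))

  Ψ-injective : ∀ {R R′} → IsPartition R → IsPartition R′ →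
    EqM (suc m) (Ψ (suc m) R) (Ψ (suc m) R′) → R ≐P R′
  Ψ-injective {R} {R′} isP isP′ ΨR≐ΨR′ = CycPair⇔⇒≐P isP isP′
    (λ {i} {j} c → Ψ-arch⁻¹ R′ (proj₁ (ΨR≐ΨR′ _ _) (Ψ-arch R c)) (toℕ-pos i) (toℕ-pos′ j))
    (λ {i} {j} c → Ψ-arch⁻¹ R (proj₂ (ΨR≐ΨR′ _ _) (Ψ-arch R′ c)) (toℕ-pos i) (toℕ-pos′ j))

  Ψ-onto-SC : ∀ {M} → IsSC (suc m) M → ∃[ R ] (IsSNC R × EqM (suc m) (Ψ (suc m) R) M)
  Ψ-onto-SC {M} (isC , symm) = Ψ⁻¹ , ((Ψ⁻¹-isPartition , Ψ⁻¹-noncrossing) , Ψ⁻¹-symmetric) , Ψ∘Ψ⁻¹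
    where
    open Preimage isC
    Ψ⁻¹-symmetric : IsSymmetricP Ψ⁻¹
    Ψ⁻¹-symmetric = σ-Invariant⇒IsSymmetricP Ψ⁻¹-isPartition (CycPair-σ-closed⇒σ-Invariant Ψ⁻¹-isPartition
      (Ψ-symmetric⇒CycPair-σ-closed Ψ⁻¹ (IsSymmetricM-resp-EqM {suc m} Ψ∘Ψ⁻¹ symm)))

mainTheorem10 : (n : ℕ) → 1 ≤ n →
    ((R : BlockRel n) → IsSNC R → IsSC n (Ψ n R)) ×
    ((R R' : BlockRel n) → IsSNC R → IsSNC R' → EqM n (Ψ n R) (Ψ n R') → R ≐P R') ×
    ((M : ArchRel n) → IsSC n M → ∃[ R ] (IsSNC R × EqM n (Ψ n R) M))
mainTheorem10 (suc m) _ =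
  (λ _ → IsSNC⇒Ψ-IsSC) ,
  (λ _ _ ((isP , _) , _) ((isP′ , _) , _) → Ψ-injective isP isP′) ,
  (λ _ → Ψ-onto-SC)
  where open Points m
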